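{- Let $G=(V,E)$ be a finite simple graph. Then $G$ is prison-free if and only if the following holds: for every inclusion-wise maximal set $F \subseteq V$ such that $G[F]$ is complete multipartite with at least $4$ parts, and for every vertex $v \in V \setminus F$, the neighbourhood $N(v)$ intersects at most one part of $F$.
   Context: The prison is the 5-vertex graph obtained from the complete graph $K_5$ by deleting two edges that share an endpoint (equivalently, the complement of the disjoint union of a path on 3 vertices and two isolated vertices). A graph is prison-free if it contains no induced subgraph isomorphic to the prison. A graph is complete multipartite with parts (classes) $P_1,\dots,P_m$ if its vertex set is the disjoint union $P_1\cup\dots\cup P_m$ and $uv$ is an edge if and only if $u$ and $v$ lie in different parts. $G[F]$ denotes the subgraph induced by $F$, and $N(v)$ the set of neighbours of $v$. -}

module Defs where

open import Data.Nat using (ℕ; _≥_)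
open import Data.Fin using (Fin)
import Data.Fin as Fin
open import Data.Fin.Subset using (Subset; _∈_; _∉_; _⊆_)
open import Data.Product using (Σ; _×_; ∃; ∃-syntax; _,_)
open import Relation.Nullary using (¬_; Dec)
open import Relation.Binary.PropositionalEquality using (_≡_; _≢_)
open import Function.Bundles using (_⇔_)
open import Function.Definitions using (Injective)

record Graph (n : ℕ) : Set₁ where
  field
    E     : Fin n → Fin n → Set
    E?    : ∀ u v → Dec (E u v)
    sym   : ∀ {u v} → E u v → E v u
    irrefl : ∀ {u} → ¬ E u u
open Graph public

data PrisonNonEdge : Fin 5 → Fin 5 → Set where
  e01 : PrisonNonEdge Fin.zero (Fin.suc Fin.zero)
  e10 : PrisonNonEdge (Fin.suc Fin.zero) Fin.zero
  e02 : PrisonNonEdge Fin.zero (Fin.suc (Fin.suc Fin.zero))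
  e20 : PrisonNonEdge (Fin.suc (Fin.suc Fin.zero)) Fin.zero

PrisonEdge : Fin 5 → Fin 5 → Set
PrisonEdge i j = (i ≢ j) × ¬ PrisonNonEdge i j

HasInducedPrison : ∀ {n} → Graph n → Set
HasInducedPrison {n} G =
  Σ (Fin 5 → Fin n) λ f →
    Injective _≡_ _≡_ f × (∀ i j → E G (f i) (f j) ⇔ PrisonEdge i j)

PrisonFree : ∀ {n} → Graph n → Set
PrisonFree G = ¬ HasInducedPrison G

record CMPartition {n} (G : Graph n) (F : Subset n) (m : ℕ) : Set where
  field
    part     : ∀ v → v ∈ F → Fin m
    nonempty : ∀ k → ∃[ v ] Σ (v ∈ F) λ v∈F → part v v∈F ≡ k
    edges    : ∀ u v (u∈F : u ∈ F) (v∈F : v ∈ F) → u ≢ v →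
               (E G u v ⇔ (part u u∈F ≢ part v v∈F))
open CMPartition public

CM4 : ∀ {n} → Graph n → Subset n → Set
CM4 G F = ∃[ m ] (m ≥ 4 × CMPartition G F m)

MaximalCM4 : ∀ {n} → Graph n → Subset n → Set
MaximalCM4 G F = CM4 G F × (∀ F' → F ⊆ F' → CM4 G F' → F' ≡ F)

MeetsAtMostOnePart : ∀ {n} {G : Graph n} {F : Subset n} {m : ℕ} →
                     CMPartition G F m → Fin n → Set
MeetsAtMostOnePart {n} {G} {F} P v =
  ∀ u w (u∈F : u ∈ F) (w∈F : w ∈ F) → E G v u → E G v w →
  part P u u∈F ≡ part P w w∈F

-- If the prison x₀ … x₄ (x₀ non-adjacent to x₁ and x₂) is induced in G, the clique {x₁, …, x₄}
-- is complete multipartite with four singleton parts and extends to a maximal such set F. Then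
-- x₀ ∉ F, for it would share a part with both ends of the edge x₁x₂; yet its neighbours x₃ and x₄
-- lie in different parts of F.
-- Conversely, let F be maximal and let v ∉ F have neighbours u, w in different parts. No part
-- contains both a neighbour and a non-neighbour of v: together with two further parts (this is
-- where four parts are needed) that would give a prison. Two non-neighbours of v in different parts
-- would form a prison with v, u and w. So v is adjacent to all of F except at most one part, and
-- F ∪ {v} is complete multipartite, with v in a new part or in that part: F was not maximal.

module Submission where

open import Defs
open import Data.Nat using (ℕ; suc; _≤_; s≤s)
open import Data.Nat.Properties using (≤-refl; m≤n⇒m≤1+n)
open import Data.Fin using (Fin; zero; suc; _≟_; punchIn; punchOut)
open import Data.Fin.Patterns using (0F; 1F; 2F; 3F; 4F)
open import Data.Fin.Properties using (any?; suc-injective; punchIn-injective; punchInᵢ≢i; punchIn-punchOut)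
open import Data.Fin.Subset using (Subset; _∈_; _∉_; _⊆_; _⊂_; _⊃_; _∪_; ⁅_⁆)
open import Data.Fin.Subset.Properties
  using (_∈?_; _⊂?_; ⊆-refl; ⊆-trans; ⊆-antisym; x∈p∪q⁻; p⊆p∪q; q⊆p∪q; x∈⁅x⁆; x∈⁅y⁆⇒x≡y)
open import Data.Fin.Subset.Induction using (Acc; acc; ⊃-wellFounded)
open import Data.Vec using ([]; _∷_; lookup; tabulate)
open import Data.Vec.Properties using (lookup∘tabulate; lookup⇒[]=; []=⇒lookup)
open import Data.Vec.Properties.WithK using ([]=-irrelevant)
open import Data.Bool.Properties using (T-≡)
open import Data.Product using (Σ; ∃-syntax; ∃₂; _×_; _,_; proj₁; proj₂)
open import Data.Sum using (_⊎_; inj₁; inj₂; [_,_]; map₂)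
open import Data.Empty using (⊥; ⊥-elim)
open import Function using (_∘_; id)
open import Function.Bundles using (_⇔_; mk⇔; Equivalence)
open import Function.Construct.Composition using (_⇔-∘_)
open import Function.Definitions using (Injective)
open import Relation.Nullary using (¬_; Dec; yes; no)
open import Relation.Nullary.Decidable using (⌊_⌋; decidable-stable; toWitness; fromWitness)
open import Relation.Binary.PropositionalEquality using (_≡_; _≢_; refl; trans; cong; subst; ≢-sym)
import Relation.Binary.PropositionalEquality as ≡

open Equivalence using (to; from)

⊆∧⊄⇒⊇ : ∀ {n} {p q : Subset n} → p ⊆ q → ¬ p ⊂ q → q ⊆ p
⊆∧⊄⇒⊇ {p = p} p⊆q p⊄q {x} x∈q = decidable-stable (x ∈? p) λ x∉p → p⊄q (p⊆q , x , x∈q , x∉p)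

module _ {n} (Q : Subset n → Set) where

  Maximal : Subset n → Set
  Maximal F = Q F × (∀ F′ → F ⊆ F′ → Q F′ → F′ ≡ F)

  -- Q need not be decidable, so a maximal extension is only obtained under double negation.
  maximal-extension : ∀ {F} → Q F → ¬ ¬ (∃[ F* ] (F ⊆ F* × Maximal F*))
  maximal-extension {F} = go (⊃-wellFounded F)
    where
    go : ∀ {F} → Acc _⊃_ F → Q F → ¬ ¬ (∃[ F* ] (F ⊆ F* × Maximal F*))
    go {F} (acc larger) QF no-maximal = no-maximal (F , ⊆-refl , QF , maximal)
      where
      maximal : ∀ F′ → F ⊆ F′ → Q F′ → F′ ≡ F
      maximal F′ F⊆F′ QF′ with F ⊂? F′
      ... | no F⊄F′  = ⊆-antisym (⊆∧⊄⇒⊇ F⊆F′ F⊄F′) F⊆F′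
      ... | yes F⊂F′ = ⊥-elim (go (larger F⊂F′) QF′ λ (F* , F′⊆F* , max) →
                                 no-maximal (F* , ⊆-trans F⊆F′ F′⊆F* , max))

  maximal⇒unextendable : ∀ {F v} → Maximal F → v ∉ F → ¬ Q (F ∪ ⁅ v ⁆)
  maximal⇒unextendable {F} {v} (_ , max) v∉F QF∪v =
    v∉F (subst (v ∈_) (max _ (p⊆p∪q ⁅ v ⁆) QF∪v) (q⊆p∪q F ⁅ v ⁆ (x∈⁅x⁆ v)))

module _ {n} {G : Graph n} {F : Subset n} {m} (P : CMPartition G F m) where

  InPart : Fin n → Fin m → Set
  InPart x i = Σ (x ∈ F) λ x∈F → part P x x∈F ≡ i

  part-irrelevant : ∀ {x} (p q : x ∈ F) → part P x p ≡ part P x q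
  part-irrelevant p q = cong (part P _) ([]=-irrelevant p q)

  different-parts⇒adjacent : ∀ {x y i j} → InPart x i → InPart y j → i ≢ j → E G x y
  different-parts⇒adjacent {x} {y} (x∈F , refl) (y∈F , refl) i≢j =
    from (edges P x y x∈F y∈F x≢y) i≢j
    where
    x≢y : x ≢ y
    x≢y refl = i≢j (part-irrelevant x∈F y∈F)

  adjacent⇒different-parts : ∀ {x y i j} → InPart x i → InPart y j → E G x y → i ≢ j
  adjacent⇒different-parts {x} {y} (x∈F , refl) (y∈F , refl) xy =
    to (edges P x y x∈F y∈F λ { refl → irrefl G xy }) xy

  non-adjacent⇒same-part : ∀ {x y i j} → InPart x i → InPart y j → ¬ E G x y → i ≡ j
  non-adjacent⇒same-part xi yj ¬xy =
    decidable-stable (_ ≟ _) (¬xy ∘ different-parts⇒adjacent xi yj)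

module _ {n} {G : Graph n} {F : Subset n} {m m′} (P : CMPartition G F m) {v} (v∉F : v ∉ F)
         (relabel : Fin m → Fin m′) (relabel-injective : Injective _≡_ _≡_ relabel) (k : Fin m′)
         (covers : ∀ j → j ≡ k ⊎ ∃[ i ] relabel i ≡ j)
         (adjacency : ∀ x (x∈F : x ∈ F) → E G v x ⇔ relabel (part P x x∈F) ≢ k) where

  private
    assign : ∀ {x} → x ∈ F ⊎ x ≡ v → Fin m′
    assign {x} = [ relabel ∘ part P x , (λ _ → k) ]

    assign-old : ∀ {x} (x∈F : x ∈ F) (s : x ∈ F ⊎ x ≡ v) → assign s ≡ relabel (part P x x∈F)
    assign-old x∈F (inj₁ x∈F′) = cong relabel (part-irrelevant P x∈F′ x∈F)
    assign-old x∈F (inj₂ refl) = ⊥-elim (v∉F x∈F)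

    assign-new : (s : v ∈ F ⊎ v ≡ v) → assign s ≡ k
    assign-new (inj₁ v∈F) = ⊥-elim (v∉F v∈F)
    assign-new (inj₂ _)   = refl

    assign-edges : ∀ {x y} (s : x ∈ F ⊎ x ≡ v) (t : y ∈ F ⊎ y ≡ v) → x ≢ y →
                   E G x y ⇔ (assign s ≢ assign t)
    assign-edges {x} {y} (inj₁ x∈F) (inj₁ y∈F) x≢y = relabel-≢ ⇔-∘ edges P x y x∈F y∈F x≢y
      where
      relabel-≢ : ∀ {i j} → i ≢ j ⇔ relabel i ≢ relabel j
      relabel-≢ = mk⇔ (λ i≢j → i≢j ∘ relabel-injective) (λ ri≢rj → ri≢rj ∘ cong relabel)
    assign-edges {x} (inj₁ x∈F) (inj₂ refl) _ = adjacency x x∈F ⇔-∘ mk⇔ (sym G) (sym G)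
    assign-edges {y = y} (inj₂ refl) (inj₁ y∈F) _ = mk⇔ ≢-sym ≢-sym ⇔-∘ adjacency y y∈F
    assign-edges (inj₂ refl) (inj₂ refl) x≢y = ⊥-elim (x≢y refl)

    ∈-insert⁻ : ∀ {x} → x ∈ F ∪ ⁅ v ⁆ → x ∈ F ⊎ x ≡ v
    ∈-insert⁻ = map₂ (x∈⁅y⁆⇒x≡y v) ∘ x∈p∪q⁻ F ⁅ v ⁆

    nonempty-inserted : ∀ j → ∃[ x ] Σ (x ∈ F ∪ ⁅ v ⁆) λ x∈ → assign (∈-insert⁻ x∈) ≡ j
    nonempty-inserted j with covers j
    ... | inj₁ refl = v , v∈ , assign-new (∈-insert⁻ v∈)
      where
      v∈ : v ∈ F ∪ ⁅ v ⁆
      v∈ = q⊆p∪q F ⁅ v ⁆ (x∈⁅x⁆ v)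
    ... | inj₂ (i , refl) with nonempty P i
    ...   | x , x∈F , refl = x , p⊆p∪q ⁅ v ⁆ x∈F , assign-old x∈F (∈-insert⁻ (p⊆p∪q ⁅ v ⁆ x∈F))

  extend-partition : CMPartition G (F ∪ ⁅ v ⁆) m′
  extend-partition = record
    { part     = λ x x∈ → assign (∈-insert⁻ x∈)
    ; nonempty = nonempty-inserted
    ; edges    = λ x y x∈ y∈ → assign-edges (∈-insert⁻ x∈) (∈-insert⁻ y∈)
    }

image : ∀ {k n} → (Fin k → Fin n) → Subset n
image g = tabulate λ x → ⌊ any? (λ i → g i ≟ x) ⌋

module _ {k n} {g : Fin k → Fin n} where

  ∈-image⁺ : ∀ i → g i ∈ image g
  ∈-image⁺ i =
    lookup⇒[]= (g i) (image g) (trans (lookup∘tabulate _ (g i)) (to T-≡ (fromWitness (i , refl))))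

  ∈-image⁻ : ∀ {x} → x ∈ image g → ∃[ i ] g i ≡ x
  ∈-image⁻ {x} x∈ = toWitness {a? = any? λ i → g i ≟ x}
    (from T-≡ (trans (≡.sym (lookup∘tabulate _ x)) ([]=⇒lookup x∈)))

clique-partition : ∀ {k n} {G : Graph n} (g : Fin k → Fin n) → Injective _≡_ _≡_ g →
                   (∀ {i j} → i ≢ j → E G (g i) (g j)) → CMPartition G (image g) k
clique-partition {G = G} g g-injective clique = record
  { part     = λ _ x∈ → proj₁ (∈-image⁻ x∈)
  ; nonempty = λ i → g i , ∈-image⁺ i , g-injective (proj₂ (∈-image⁻ (∈-image⁺ {g = g} i)))
  ; edges    = λ _ _ x∈ y∈ _ → preimage-edges (∈-image⁻ x∈) (∈-image⁻ y∈)
  }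
  where
  preimage-edges : ∀ {x y} (x′ : ∃[ i ] g i ≡ x) (y′ : ∃[ j ] g j ≡ y) →
                   E G x y ⇔ proj₁ x′ ≢ proj₁ y′
  preimage-edges (i , refl) (j , refl) = mk⇔ (λ { gij refl → irrefl G gij }) clique

nonEdge? : ∀ i j → Dec (PrisonNonEdge i j)
nonEdge? 0F 1F                  = yes e01
nonEdge? 0F 2F                  = yes e02
nonEdge? 1F 0F                  = yes e10
nonEdge? 2F 0F                  = yes e20
nonEdge? 0F 0F                  = no λ ()
nonEdge? 0F (suc (suc (suc _))) = no λ ()
nonEdge? 1F (suc _)             = no λ ()
nonEdge? 2F (suc _)             = no λ ()
nonEdge? (suc (suc (suc _))) _  = no λ ()

module _ {n} {G : Graph n} {f : Fin 5 → Fin n}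
         (induced : ∀ i j → E G (f i) (f j) ⇔ PrisonEdge i j) where

  private
    twins-share-neighbours : ∀ {i j l} → f i ≡ f j → PrisonEdge i l → PrisonEdge j l
    twins-share-neighbours {i} {j} {l} fi≡fj il =
      to (induced j l) (subst (λ x → E G x (f l)) fi≡fj (from (induced i l) il))

    1~2 : PrisonEdge 1F 2F
    1~2 = (λ ()) , (λ ())

    2~1 : PrisonEdge 2F 1F
    2~1 = (λ ()) , (λ ())

  -- The prison has no twins: its only non-adjacent pairs, 0–1 and 0–2, are separated by the edge 1–2.
  induced-prison-injective : Injective _≡_ _≡_ f
  induced-prison-injective {i} {j} fi≡fj with i ≟ j | nonEdge? i j
  ... | yes i≡j | _       = i≡j
  ... | no i≢j  | no ¬ij  =
    ⊥-elim (irrefl G (subst (E G (f i)) (≡.sym fi≡fj) (from (induced i j) (i≢j , ¬ij))))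
  ... | no _    | yes e01 = ⊥-elim (proj₂ (twins-share-neighbours (≡.sym fi≡fj) 1~2) e02)
  ... | no _    | yes e10 = ⊥-elim (proj₂ (twins-share-neighbours fi≡fj 1~2) e02)
  ... | no _    | yes e02 = ⊥-elim (proj₂ (twins-share-neighbours (≡.sym fi≡fj) 2~1) e01)
  ... | no _    | yes e20 = ⊥-elim (proj₂ (twins-share-neighbours fi≡fj 2~1) e01)

module _ {n} {G : Graph n} {a b c d e : Fin n}
         (¬ab : ¬ E G a b) (¬ac : ¬ E G a c) (bc : E G b c)
         (ad : E G a d) (bd : E G b d) (cd : E G c d)
         (ae : E G a e) (be : E G b e) (ce : E G c e) (de : E G d e) where

  private
    f : Fin 5 → Fin n
    f = lookup (a ∷ b ∷ c ∷ d ∷ e ∷ [])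

    edge : ∀ i j → PrisonEdge i j → E G (f i) (f j)
    edge 0F 0F (0≢0 , _) = ⊥-elim (0≢0 refl)
    edge 0F 1F (_ , ¬ne) = ⊥-elim (¬ne e01)
    edge 0F 2F (_ , ¬ne) = ⊥-elim (¬ne e02)
    edge 0F 3F _         = ad
    edge 0F 4F _         = ae
    edge 1F 0F (_ , ¬ne) = ⊥-elim (¬ne e10)
    edge 1F 1F (1≢1 , _) = ⊥-elim (1≢1 refl)
    edge 1F 2F _         = bc
    edge 1F 3F _         = bd
    edge 1F 4F _         = be
    edge 2F 0F (_ , ¬ne) = ⊥-elim (¬ne e20)
    edge 2F 1F _         = sym G bc
    edge 2F 2F (2≢2 , _) = ⊥-elim (2≢2 refl)
    edge 2F 3F _         = cd
    edge 2F 4F _         = ce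
    edge 3F 0F _         = sym G ad
    edge 3F 1F _         = sym G bd
    edge 3F 2F _         = sym G cd
    edge 3F 3F (3≢3 , _) = ⊥-elim (3≢3 refl)
    edge 3F 4F _         = de
    edge 4F 0F _         = sym G ae
    edge 4F 1F _         = sym G be
    edge 4F 2F _         = sym G ce
    edge 4F 3F _         = sym G de
    edge 4F 4F (4≢4 , _) = ⊥-elim (4≢4 refl)

    non-edge : ∀ {i j} → PrisonNonEdge i j → ¬ E G (f i) (f j)
    non-edge e01 = ¬ab
    non-edge e10 = ¬ab ∘ sym G
    non-edge e02 = ¬ac
    non-edge e20 = ¬ac ∘ sym G

    induced : ∀ i j → E G (f i) (f j) ⇔ PrisonEdge i j
    induced i j = mk⇔ (λ fij → (λ { refl → irrefl G fij }) , λ ne → non-edge ne fij) (edge i j)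

  induced-prison : HasInducedPrison G
  induced-prison = f , induced-prison-injective {G = G} induced , induced

two-other-indices : ∀ {m} {k l : Fin m} → 4 ≤ m → k ≢ l →
                    ∃₂ λ c d → c ≢ d × (c ≢ k × c ≢ l) × (d ≢ k × d ≢ l)
two-other-indices {k = k} {l} (s≤s (s≤s (s≤s (s≤s _)))) k≢l =
  skip 0F , skip 1F , (λ ()) ∘ skip-injective , (skip≢k 0F , skip≢l 0F) , (skip≢k 1F , skip≢l 1F)
  where
  l′ : Fin _
  l′ = punchOut k≢l

  skip : Fin _ → Fin _
  skip = punchIn k ∘ punchIn l′

  skip-injective : Injective _≡_ _≡_ skip
  skip-injective = punchIn-injective l′ _ _ ∘ punchIn-injective k _ _

  skip≢k : ∀ i → skip i ≢ k
  skip≢k i = punchInᵢ≢i k (punchIn l′ i)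

  skip≢l : ∀ i → skip i ≢ l
  skip≢l i eq = punchInᵢ≢i l′ i (punchIn-injective k _ _ (trans eq (≡.sym (punchIn-punchOut k≢l))))

module _ {n} {G : Graph n} (prison-free : PrisonFree G)
         {F : Subset n} {m} (P : CMPartition G F m) (4≤m : 4 ≤ m)
         {v} (v∉F : v ∉ F) (unextendable : ¬ CM4 G (F ∪ ⁅ v ⁆)) where

  private
    across : ∀ {x y i j} → InPart P x i → InPart P y j → i ≢ j → E G x y
    across = different-parts⇒adjacent P

  split-part-with-two-neighbours : ∀ {z z′ a b k i j} → InPart P z k → InPart P z′ k →
    InPart P a i → InPart P b j → i ≢ k → j ≢ k → i ≢ j →
    ¬ E G v z → E G v z′ → E G v a → E G v b → ⊥
  split-part-with-two-neighbours zk z′k ai bj i≢k j≢k i≢j ¬vz vz′ va vb =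
    prison-free (induced-prison {G = G} (¬vz ∘ sym G) (λ zz′ → adjacent⇒different-parts P zk z′k zz′ refl)
      vz′
      (across zk ai (≢-sym i≢k)) va (across z′k ai (≢-sym i≢k))
      (across zk bj (≢-sym j≢k)) vb (across z′k bj (≢-sym j≢k)) (across ai bj i≢j))

  split-part-with-neighbour : ∀ {z z′ a k i} → InPart P z k → InPart P z′ k → InPart P a i → i ≢ k →
    ¬ E G v z → E G v z′ → E G v a → ⊥
  -- x and y represent two parts other than k and i; this is where 4 ≤ m is needed.
  split-part-with-neighbour zk z′k ai i≢k ¬vz vz′ va
    with c , d , c≢d , (c≢k , c≢i) , (d≢k , d≢i) ← two-other-indices 4≤m (≢-sym i≢k)
    with x , xc ← nonempty P c
    with y , yd ← nonempty P d
    with E? G v x | E? G v y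
  ... | yes vx | _      = split-part-with-two-neighbours zk z′k ai xc i≢k c≢k (≢-sym c≢i) ¬vz vz′ va vx
  ... | no _   | yes vy = split-part-with-two-neighbours zk z′k ai yd i≢k d≢k (≢-sym d≢i) ¬vz vz′ va vy
  ... | no ¬vx | no ¬vy =
    prison-free (induced-prison {G = G} ¬vx ¬vy (across xc yd c≢d)
      vz′ (across xc z′k c≢k) (across yd z′k d≢k)
      va (across xc ai c≢i) (across yd ai d≢i) (across z′k ai (≢-sym i≢k)))

  module _ {u w i j} (ui : InPart P u i) (wj : InPart P w j) (i≢j : i ≢ j)
           (vu : E G v u) (vw : E G v w) where

    no-split-part : ∀ {z z′ k} → InPart P z k → InPart P z′ k → ¬ E G v z → E G v z′ → ⊥
    no-split-part {k = k} zk z′k ¬vz vz′ with i ≟ k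
    ... | yes refl = split-part-with-neighbour zk z′k wj (≢-sym i≢j) ¬vz vz′ vw
    ... | no i≢k   = split-part-with-neighbour zk z′k ui i≢k ¬vz vz′ vu

    non-neighbour-adjacent-to-neighbour : ∀ {y t k l} → InPart P y k → InPart P t l →
      ¬ E G v y → E G v t → E G y t
    non-neighbour-adjacent-to-neighbour yk tl ¬vy vt = across yk tl λ { refl → no-split-part yk tl ¬vy vt }

    neighbourhood-is-complement-of-part : ∀ {z k} → InPart P z k → ¬ E G v z →
      ∀ x (x∈F : x ∈ F) → E G v x ⇔ part P x x∈F ≢ k
    neighbourhood-is-complement-of-part zk ¬vz x x∈F = mk⇔
      (λ vx x∈k → no-split-part zk (x∈F , x∈k) ¬vz vx)
      (λ x∉k → decidable-stable (E? G v x) λ ¬vx →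
        prison-free (induced-prison {G = G} ¬vz ¬vx (across zk xp (≢-sym x∉k))
          vu (cross zk ui ¬vz vu) (cross xp ui ¬vx vu)
          vw (cross zk wj ¬vz vw) (cross xp wj ¬vx vw) (across ui wj i≢j)))
      where
      xp : InPart P x (part P x x∈F)
      xp = x∈F , refl
      cross : ∀ {y t k l} → InPart P y k → InPart P t l → ¬ E G v y → E G v t → E G y t
      cross = non-neighbour-adjacent-to-neighbour

    adjacent-to-all : ∀ x → x ∈ F → E G v x
    adjacent-to-all x x∈F = decidable-stable (E? G v x) λ ¬vx →
      unextendable (m , 4≤m , extend-partition P v∉F id id (part P x x∈F) (λ j → inj₂ (j , refl))
                                (neighbourhood-is-complement-of-part (x∈F , refl) ¬vx))

  neighbourhood-independent : ∀ {u w} → u ∈ F → w ∈ F → E G v u → E G v w → ¬ E G u w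
  neighbourhood-independent {u} {w} u∈F w∈F vu vw uw =
    unextendable (suc m , m≤n⇒m≤1+n 4≤m , extend-partition P v∉F suc suc-injective 0F new-or-old
      λ x x∈F → mk⇔ (λ _ ()) (λ _ → adjacent-to-all ui wj (adjacent⇒different-parts P ui wj uw) vu vw x x∈F))
    where
    ui : InPart P u (part P u u∈F)
    ui = u∈F , refl
    wj : InPart P w (part P w w∈F)
    wj = w∈F , refl
    new-or-old : ∀ j → j ≡ 0F ⊎ ∃[ i ] suc i ≡ j
    new-or-old 0F      = inj₁ refl
    new-or-old (suc i) = inj₂ (i , refl)

NeighbourhoodsMeetOnePart : ∀ {n} → Graph n → Set
NeighbourhoodsMeetOnePart {n} G =
  ∀ (F : Subset n) → MaximalCM4 G F → ∀ {m} (P : CMPartition G F m) → ∀ v → v ∉ F → MeetsAtMostOnePart P v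

prison-free⇒neighbourhoods-meet-one-part : ∀ {n} {G : Graph n} → PrisonFree G → NeighbourhoodsMeetOnePart G
prison-free⇒neighbourhoods-meet-one-part {G = G} prison-free F max@((_ , 4≤m , P′) , _) P v v∉F
                                         u w u∈F w∈F vu vw =
  non-adjacent⇒same-part P (u∈F , refl) (w∈F , refl)
    (neighbourhood-independent prison-free P′ 4≤m v∉F (maximal⇒unextendable (CM4 G) max v∉F) u∈F w∈F vu vw)

neighbourhoods-meet-one-part⇒prison-free : ∀ {n} {G : Graph n} → NeighbourhoodsMeetOnePart G → PrisonFree G
neighbourhoods-meet-one-part⇒prison-free {G = G} one-part (f , f-injective , induced) =
  maximal-extension (CM4 G) (4 , ≤-refl , clique-partition (f ∘ suc) (suc-injective ∘ f-injective) clique) refute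
  where
  adj : ∀ i j → PrisonEdge i j → E G (f i) (f j)
  adj i j = from (induced i j)

  non-adj : ∀ {i j} → PrisonNonEdge i j → ¬ E G (f i) (f j)
  non-adj ne fij = proj₂ (to (induced _ _) fij) ne

  clique : ∀ {i j} → i ≢ j → E G (f (suc i)) (f (suc j))
  clique i≢j = adj _ _ ((i≢j ∘ suc-injective) , λ ())

  refute : ¬ (∃[ F ] (image (f ∘ suc) ⊆ F × MaximalCM4 G F))
  refute (F , K⊆F , max@((_ , _ , P) , _)) =
    adjacent⇒different-parts P (f∈F 2F , refl) (f∈F 3F , refl) (adj 3F 4F ((λ ()) , (λ ())))
      (one-part F max P (f 0F) f0∉F (f 3F) (f 4F) (f∈F 2F) (f∈F 3F)
        (adj 0F 3F ((λ ()) , (λ ()))) (adj 0F 4F ((λ ()) , (λ ()))))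
    where
    f∈F : ∀ i → f (suc i) ∈ F
    f∈F i = K⊆F (∈-image⁺ i)

    f0∉F : f 0F ∉ F
    f0∉F f0∈F = adjacent⇒different-parts P (f∈F 0F , refl) (f∈F 1F , refl) (adj 1F 2F ((λ ()) , (λ ())))
      (trans (≡.sym (non-adjacent⇒same-part P (f0∈F , refl) (f∈F 0F , refl) (non-adj e01)))
             (non-adjacent⇒same-part P (f0∈F , refl) (f∈F 1F , refl) (non-adj e02)))

theorem2 : ∀ {n : ℕ} (G : Graph n) →
    PrisonFree G ⇔
    (∀ (F : Subset n) → MaximalCM4 G F →
      ∀ {m : ℕ} (P : CMPartition G F m) → ∀ v → v ∉ F → MeetsAtMostOnePart P v)
theorem2 G = mk⇔ prison-free⇒neighbourhoods-meet-one-part neighbourhoods-meet-one-part⇒prison-free
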